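{- Let $p$ be an odd prime with $3\mid p-1$ and $p\nmid 2^{(p-1)/3}-1$. Then for every integer $r$ with $0<r<p-1$ and $\gcd(r,\frac{p-1}{3})=1$ and every positive integer $e$ with $\gcd(e,3)=1$, the binomial $x^r\big(x^{e(p-1)/3}+1\big)$ is not a permutation polynomial of $\mathbb{F}_p$.
   Context: A permutation polynomial of $\mathbb{F}_p$ is one inducing a bijection of $\mathbb{F}_p$. -}

module Defs where

open import Data.Nat using (ℕ; _+_; _*_; _^_; _∸_; NonZero)
open import Data.Nat.DivMod using (_%_; _/_; m%n<n)
open import Data.Fin using (fromℕ<)
open import Data.Fin using (Fin; toℕ)
open import Function.Definitions using (Bijective)
open import Relation.Binary.PropositionalEquality using (_≡_)

-- Elements of 𝔽_p are represented by Fin p (residues 0,…,p-1).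
-- A polynomial function 𝔽_p → 𝔽_p is given by its value on each residue.

binomialMap : (p : ℕ) .{{_ : NonZero p}} (r e : ℕ) → Fin p → Fin p
binomialMap p r e x = fromℕ< (m%n<n (toℕ x ^ r * (toℕ x ^ (e * ((p ∸ 1) / 3)) + 1)) p)

IsPermutationPolynomial : (p : ℕ) → (Fin p → Fin p) → Set
IsPermutationPolynomial p f = Bijective _≡_ _≡_ f

-- Let k = (p - 1)/3 and f(x) = xʳ (x^(ek) + 1). If f(y)ᵏ = f(x)ᵏ ≠ 0 then f(y) = s f(x) with
-- sᵏ = 1; as gcd(r, k) = 1 there is t with tᵏ = 1 and tʳ = s, so f(x t) = f(y), and injectivity
-- of f forces xᵏ = yᵏ. By Fermat and the hypothesis on 2, ω = 2ᵏ is a primitive cube root of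
-- unity, and so is v = ωᵉ since 3 ∤ e. Then f(1) = 2, f(2) = 2ʳ (v + 1) and
-- f(4) = 4ʳ (v² + 1) = -f(2)², so, k being even, f(4)ᵏ = (f(2)ᵏ)² where f(2)ᵏ ∈ {1, ω, ω²}.
-- Each of the three cases makes two of 1ᵏ = 1, 2ᵏ = ω, 4ᵏ = ω² equal.

module Submission where

open import Defs
open import Level using (0ℓ)
open import Data.Nat using (ℕ; zero; suc; _+_; _*_; _^_; _∸_; _<_; _≤_; _!; NonZero; s≤s; z<s; s<s;
  nonTrivial⇒n>1; +-*-rawSemiring; +-0-rawMonoid)
open import Data.Nat.Properties
open import Data.Nat.DivMod using (_%_; _/_; m%n<n; m%n%n≡m%n; m%n≤n; %-distribˡ-+; %-distribˡ-*;
  m*[n/m]≡n; m≡m%n+[m/n]*n)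
open import Data.Nat.Divisibility using (_∣_; _∤_; divides; ∣-refl; _∣0; ∣1⇒≡1; ∣m+n∣m⇒∣n; ∣m⇒∣m*n;
  m∣m*n; ∣⇒≤; quotient; m∣n⇒n≡m*quotient; m%n≡0⇒n∣m; n∣m⇒m%n≡0)
open import Data.Nat.GCD using (gcd; module Bézout)
open import Data.Nat.Coprimality using (gcd≡1⇒coprime; coprime-Bézout)
open import Data.Nat.Primality using (Prime; euclidsLemma; ¬prime[1]; prime⇒nonTrivial; prime⇒irreducible;
  irreducible[2])
open import Data.Nat.Combinatorics using (_C_; nCn≡1; nCk≡n!/k![n-k]!; k![n∸k]!∣n!)
open import Data.Nat.Tactic.RingSolver using (solve-∀)
open import Data.Fin using (Fin; zero; suc; toℕ; fromℕ<)
open import Data.Fin.Properties using (toℕ-fromℕ; toℕ-fromℕ<; toℕ-injective; toℕ-inject₁; toℕ<n)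
open import Data.Vec.Functional using (Vector; tail; init; last)
open import Data.Empty using (⊥; ⊥-elim)
open import Data.Product using (∃-syntax; _,_; _×_; proj₁; proj₂)
open import Data.Sum using (_⊎_; inj₁; inj₂; [_,_]′)
open import Function.Definitions using (Injective)
open import Relation.Binary.Bundles using (Setoid)
open import Relation.Binary.PropositionalEquality
import Relation.Binary.Reasoning.Setoid as SetoidReasoning
open import Relation.Nullary using (¬_; yes; no)
open import Algebra.Properties.CommutativeSemigroup *-commutativeSemigroup using (x∙yz≈y∙xz)
open import Algebra.Properties.Monoid.Sum +-0-monoid using (sum; sum⁺-syntax; sum-init-last; sum-cong-≗)
import Algebra.Properties.CommutativeSemiring.Binomial +-*-commutativeSemiring as Binomial
import Algebra.Definitions.RawSemiring +-*-rawSemiring as RawSemiring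
import Algebra.Definitions.RawMonoid +-0-rawMonoid as RawMonoid

^-distribʳ-* : ∀ a b n → (a * b) ^ n ≡ a ^ n * b ^ n
^-distribʳ-* a b zero    = refl
^-distribʳ-* a b (suc n) = begin
  a * b * (a * b) ^ n        ≡⟨ cong (a * b *_) (^-distribʳ-* a b n) ⟩
  a * b * (a ^ n * b ^ n)    ≡⟨ *-assoc a b _ ⟩
  a * (b * (a ^ n * b ^ n))  ≡⟨ cong (a *_) (x∙yz≈y∙xz b (a ^ n) (b ^ n)) ⟩
  a * (a ^ n * (b * b ^ n))  ≡⟨ *-assoc a (a ^ n) _ ⟨
  a * a ^ n * (b * b ^ n)    ∎
  where open ≡-Reasoning

[a^m]^n≡[a^n]^m : ∀ a m n → (a ^ m) ^ n ≡ (a ^ n) ^ m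
[a^m]^n≡[a^n]^m a m n = begin
  (a ^ m) ^ n  ≡⟨ ^-*-assoc a m n ⟩
  a ^ (m * n)  ≡⟨ cong (a ^_) (*-comm m n) ⟩
  a ^ (n * m)  ≡⟨ ^-*-assoc a n m ⟨
  (a ^ n) ^ m  ∎
  where open ≡-Reasoning

0^n≡0 : ∀ n .{{_ : NonZero n}} → 0 ^ n ≡ 0
0^n≡0 (suc n) = refl

n∣n! : ∀ n .{{_ : NonZero n}} → n ∣ n !
n∣n! (suc n) = m∣m*n (n !)

2∣odd-prime∸1 : ∀ {p} → Prime p → p ≢ 2 → 2 ∣ p ∸ 1
2∣odd-prime∸1 {p} p-prime p≢2 with p % 2 in p%2≡0 | m%n<n p 2 | m≡m%n+[m/n]*n p 2
... | 1           | _            | p≡1+[p/2]*2 = divides (p / 2) (cong (_∸ 1) p≡1+[p/2]*2)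
... | suc (suc _) | s≤s (s≤s ()) | _
... | 0           | _            | _ with prime⇒irreducible p-prime (m%n≡0⇒n∣m p 2 p%2≡0)
...   | inj₂ 2≡p = ⊥-elim (p≢2 (sym 2≡p))

2∣3k⇒2∣k : ∀ {k} → 2 ∣ 3 * k → 2 ∣ k
2∣3k⇒2∣k {k} 2∣3k = ∣m+n∣m⇒∣n (subst (2 ∣_) (+-comm k (2 * k)) 2∣3k) (m∣m*n k)

semiring-^≡^ : ∀ x n → x RawSemiring.^ n ≡ x ^ n
semiring-^≡^ x zero    = refl
semiring-^≡^ x (suc n) = cong (x *_) (semiring-^≡^ x n)

monoid-×≡* : ∀ n x → n RawMonoid.× x ≡ n * x
monoid-×≡* zero    x = refl
monoid-×≡* (suc n) x = cong (x +_) (monoid-×≡* n x)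

binomial-theorem : ∀ n x → (x + 1) ^ n ≡ ∑[ k ≤ n ] ((n C toℕ k) * x ^ toℕ k)
binomial-theorem n x = begin
  (x + 1) ^ n                              ≡⟨ semiring-^≡^ (x + 1) n ⟨
  (x + 1) RawSemiring.^ n                  ≡⟨ Binomial.theorem n x 1 ⟩
  Binomial.binomialExpansion x 1 n         ≡⟨ sum-cong-≗ term ⟩
  ∑[ k ≤ n ] ((n C toℕ k) * x ^ toℕ k)       ∎
  where
  open ≡-Reasoning
  term : ∀ k → Binomial.binomialTerm x 1 n k ≡ (n C toℕ k) * x ^ toℕ k
  term k = begin
    (n C i) RawMonoid.× (x RawSemiring.^ i * 1 RawSemiring.^ (n ∸ i))
      ≡⟨ monoid-×≡* (n C i) _ ⟩
    (n C i) * (x RawSemiring.^ i * 1 RawSemiring.^ (n ∸ i))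
      ≡⟨ cong₂ (λ a b → (n C i) * (a * b)) (semiring-^≡^ x i) (trans (semiring-^≡^ 1 (n ∸ i)) (^-zeroˡ (n ∸ i))) ⟩
    (n C i) * (x ^ i * 1)
      ≡⟨ cong ((n C i) *_) (*-identityʳ (x ^ i)) ⟩
    (n C i) * x ^ i
      ∎
    where
    i : ℕ
    i = toℕ k

Φ₃ : ℕ → ℕ
Φ₃ z = z * z + z + 1

module Congruence (p : ℕ) .{{_ : NonZero p}} where

  infix 4 _≈_
  _≈_ : ℕ → ℕ → Set
  a ≈ b = a % p ≡ b % p

  ≈-setoid : Setoid 0ℓ 0ℓ
  ≈-setoid = record
    { Carrier = ℕ ; _≈_ = _≈_
    ; isEquivalence = record { refl = refl ; sym = sym ; trans = trans } }

  module ≈-Reasoning = SetoidReasoning ≈-setoid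

  ≡⇒≈ : ∀ {a b} → a ≡ b → a ≈ b
  ≡⇒≈ = cong (_% p)

  %-≈ : ∀ a → a % p ≈ a
  %-≈ a = m%n%n≡m%n a p

  +-cong : ∀ {a b c d} → a ≈ b → c ≈ d → a + c ≈ b + d
  +-cong {a} {b} {c} {d} a≈b c≈d = begin
    (a + c) % p          ≡⟨ %-distribˡ-+ a c p ⟩
    (a % p + c % p) % p  ≡⟨ cong₂ (λ u v → (u + v) % p) a≈b c≈d ⟩
    (b % p + d % p) % p  ≡⟨ %-distribˡ-+ b d p ⟨
    (b + d) % p          ∎
    where open ≡-Reasoning

  *-cong : ∀ {a b c d} → a ≈ b → c ≈ d → a * c ≈ b * d
  *-cong {a} {b} {c} {d} a≈b c≈d = begin
    (a * c) % p              ≡⟨ %-distribˡ-* a c p ⟩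
    (a % p * (c % p)) % p    ≡⟨ cong₂ (λ u v → (u * v) % p) a≈b c≈d ⟩
    (b % p * (d % p)) % p    ≡⟨ %-distribˡ-* b d p ⟨
    (b * d) % p              ∎
    where open ≡-Reasoning

  +-congˡ : ∀ a {b c} → b ≈ c → a + b ≈ a + c
  +-congˡ a = +-cong {a} refl

  +-congʳ : ∀ a {b c} → b ≈ c → b + a ≈ c + a
  +-congʳ a b≈c = +-cong b≈c (refl {x = a % p})

  *-congˡ : ∀ a {b c} → b ≈ c → a * b ≈ a * c
  *-congˡ a = *-cong {a} refl

  *-congʳ : ∀ a {b c} → b ≈ c → b * a ≈ c * a
  *-congʳ a b≈c = *-cong b≈c (refl {x = a % p})

  ^-cong : ∀ {a b} n → a ≈ b → a ^ n ≈ b ^ n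
  ^-cong zero    a≈b = refl
  ^-cong (suc n) a≈b = *-cong a≈b (^-cong n a≈b)

  0%p≡0 : 0 % p ≡ 0
  0%p≡0 = n∣m⇒m%n≡0 0 p (p ∣0)

  ∣⇒≈0 : ∀ {a} → p ∣ a → a ≈ 0
  ∣⇒≈0 {a} p∣a = trans (n∣m⇒m%n≡0 a p p∣a) (sym 0%p≡0)

  ≈0⇒∣ : ∀ {a} → a ≈ 0 → p ∣ a
  ≈0⇒∣ {a} a≈0 = m%n≡0⇒n∣m a p (trans a≈0 0%p≡0)

  +-inverseʳ : ∀ a → a + (p ∸ a % p) ≈ 0
  +-inverseʳ a = begin
    a + (p ∸ a % p)        ≈⟨ +-congʳ (p ∸ a % p) (%-≈ a) ⟨
    a % p + (p ∸ a % p)    ≡⟨ m+[n∸m]≡n (m%n≤n a p) ⟩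
    p                      ≈⟨ ∣⇒≈0 ∣-refl ⟩
    0                      ∎
    where open ≈-Reasoning

  +-cancelˡ : ∀ a {b c} → a + b ≈ a + c → b ≈ c
  +-cancelˡ a {b} {c} eq = begin
    b                          ≡⟨ +-identityˡ b ⟨
    0 + b                      ≈⟨ +-congʳ b (+-inverseʳ a) ⟨
    a + (p ∸ a % p) + b        ≡⟨ cong (_+ b) (+-comm a _) ⟩
    (p ∸ a % p) + a + b        ≡⟨ +-assoc _ a b ⟩
    (p ∸ a % p) + (a + b)      ≈⟨ +-congˡ (p ∸ a % p) eq ⟩
    (p ∸ a % p) + (a + c)      ≡⟨ +-assoc _ a c ⟨
    (p ∸ a % p) + a + c        ≡⟨ cong (_+ c) (+-comm _ a) ⟩
    a + (p ∸ a % p) + c        ≈⟨ +-congʳ c (+-inverseʳ a) ⟩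
    c                          ∎
    where open ≈-Reasoning

  ∃-difference : ∀ a b → ∃[ d ] a + d ≈ b
  ∃-difference a b = (p ∸ a % p) + b , (begin
    a + ((p ∸ a % p) + b)      ≡⟨ +-assoc a _ b ⟨
    a + (p ∸ a % p) + b        ≈⟨ +-congʳ b (+-inverseʳ a) ⟩
    b                          ∎)
    where open ≈-Reasoning

  ^-≈1 : ∀ {a} n → a ≈ 1 → a ^ n ≈ 1
  ^-≈1 {a} n a≈1 = trans (^-cong n a≈1) (≡⇒≈ (^-zeroˡ n))

  ∸-≈0 : ∀ {a b} → b ≤ a → a ≈ b → a ∸ b ≈ 0
  ∸-≈0 {a} {b} b≤a a≈b = +-cancelˡ b (begin
    b + (a ∸ b)   ≡⟨ m+[n∸m]≡n b≤a ⟩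
    a             ≈⟨ a≈b ⟩
    b             ≡⟨ +-identityʳ b ⟨
    b + 0         ∎)
    where open ≈-Reasoning

  inverse-unique : ∀ a {b c} → a * b ≈ 1 → a * c ≈ 1 → b ≈ c
  inverse-unique a {b} {c} ab≈1 ac≈1 = begin
    b              ≡⟨ *-identityʳ b ⟨
    b * 1          ≈⟨ *-congˡ b ac≈1 ⟨
    b * (a * c)    ≡⟨ *-assoc b a c ⟨
    b * a * c      ≡⟨ cong (_* c) (*-comm b a) ⟩
    a * b * c      ≈⟨ *-congʳ c ab≈1 ⟩
    1 * c          ≡⟨ *-identityˡ c ⟩
    c              ∎
    where open ≈-Reasoning

  ^-*-≈1 : ∀ {a} n j → a ^ n ≈ 1 → a ^ (j * n) ≈ 1
  ^-*-≈1 {a} n j aⁿ≈1 = trans (≡⇒≈ (sym (trans ([a^m]^n≡[a^n]^m a n j) (^-*-assoc a j n)))) (^-≈1 j aⁿ≈1)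

  ≈1-if-successive-powers : ∀ {a u w} → 1 + u ≡ w → a ^ u ≈ 1 → a ^ w ≈ 1 → a ≈ 1
  ≈1-if-successive-powers {a} {u} refl aᵘ≈1 aʷ≈1 = begin
    a          ≡⟨ *-identityʳ a ⟨
    a * 1      ≈⟨ *-congˡ a aᵘ≈1 ⟨
    a * a ^ u  ≈⟨ aʷ≈1 ⟩
    1          ∎
    where open ≈-Reasoning

  ≈1-if-coprime-powers : ∀ {a m n} → gcd m n ≡ 1 → a ^ m ≈ 1 → a ^ n ≈ 1 → a ≈ 1
  ≈1-if-coprime-powers {m = m} {n} gcd≡1 aᵐ≈1 aⁿ≈1 with coprime-Bézout (gcd≡1⇒coprime gcd≡1)
  ... | Bézout.+- x y eq = ≈1-if-successive-powers eq (^-*-≈1 n y aⁿ≈1) (^-*-≈1 m x aᵐ≈1)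
  ... | Bézout.-+ x y eq = ≈1-if-successive-powers eq (^-*-≈1 m x aᵐ≈1) (^-*-≈1 n y aⁿ≈1)

  ∃-root-by-power : ∀ {r k s x y} → 1 + y * k ≡ x * r → s ^ k ≈ 1 → ∃[ t ] t ^ k ≈ 1 × t ^ r ≈ s
  ∃-root-by-power {r} {k} {s} {x} {y} eq sᵏ≈1 = s ^ x , tᵏ≈1 , tʳ≈s
    where
    open ≈-Reasoning
    tᵏ≈1 : (s ^ x) ^ k ≈ 1
    tᵏ≈1 = trans (≡⇒≈ ([a^m]^n≡[a^n]^m s x k)) (^-≈1 x sᵏ≈1)
    tʳ≈s : (s ^ x) ^ r ≈ s
    tʳ≈s = begin
      (s ^ x) ^ r      ≡⟨ ^-*-assoc s x r ⟩
      s ^ (x * r)      ≡⟨ cong (s ^_) eq ⟨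
      s * s ^ (y * k)  ≈⟨ *-congˡ s (^-*-≈1 k y sᵏ≈1) ⟩
      s * 1            ≡⟨ *-identityʳ s ⟩
      s                ∎

  -- s ^ k inverts s, and x r ≡ -1 (mod k + 1) makes (s ^ k) ^ x an r-th root of s
  ∃-root-by-inverse : ∀ {r k s x y} → 1 + x * r ≡ y * k → s ^ k ≈ 1 → ∃[ t ] t ^ k ≈ 1 × t ^ r ≈ s
  ∃-root-by-inverse {k = zero} {x = x} {y} eq _ = ⊥-elim (1+n≢0 (trans eq (*-zeroʳ y)))
  ∃-root-by-inverse {r} {suc k} {s} {x} {y} eq sᵏ⁺¹≈1 = (s ^ k) ^ x , tᵏ⁺¹≈1 , tʳ≈s
    where
    open ≈-Reasoning
    tᵏ⁺¹≈1 : ((s ^ k) ^ x) ^ suc k ≈ 1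
    tᵏ⁺¹≈1 = begin
      ((s ^ k) ^ x) ^ suc k  ≡⟨ [a^m]^n≡[a^n]^m (s ^ k) x (suc k) ⟩
      ((s ^ k) ^ suc k) ^ x  ≡⟨ cong (_^ x) ([a^m]^n≡[a^n]^m s k (suc k)) ⟩
      ((s ^ suc k) ^ k) ^ x  ≈⟨ ^-≈1 x (^-≈1 k sᵏ⁺¹≈1) ⟩
      1                      ∎
    sˣʳ⁺¹≈1 : s ^ (x * r) * s ≈ 1
    sˣʳ⁺¹≈1 = begin
      s ^ (x * r) * s  ≡⟨ *-comm _ s ⟩
      s ^ (1 + x * r)  ≡⟨ cong (s ^_) eq ⟩
      s ^ (y * suc k)  ≈⟨ ^-*-≈1 (suc k) y sᵏ⁺¹≈1 ⟩
      1                ∎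
    sˣʳtʳ≈1 : s ^ (x * r) * ((s ^ k) ^ x) ^ r ≈ 1
    sˣʳtʳ≈1 = begin
      s ^ (x * r) * ((s ^ k) ^ x) ^ r  ≡⟨ cong (s ^ (x * r) *_) (^-*-assoc (s ^ k) x r) ⟩
      s ^ (x * r) * (s ^ k) ^ (x * r)  ≡⟨ ^-distribʳ-* s (s ^ k) (x * r) ⟨
      (s ^ suc k) ^ (x * r)            ≈⟨ ^-≈1 (x * r) sᵏ⁺¹≈1 ⟩
      1                                ∎
    tʳ≈s : ((s ^ k) ^ x) ^ r ≈ s
    tʳ≈s = inverse-unique (s ^ (x * r)) sˣʳtʳ≈1 sˣʳ⁺¹≈1

  ∃-root : ∀ {r k s} → gcd r k ≡ 1 → s ^ k ≈ 1 → ∃[ t ] t ^ k ≈ 1 × t ^ r ≈ s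
  ∃-root {r} {k} {s} gcd≡1 sᵏ≈1 with coprime-Bézout (gcd≡1⇒coprime gcd≡1)
  ... | Bézout.+- x y eq = ∃-root-by-power {r} {k} {s} {x} {y} eq sᵏ≈1
  ... | Bézout.-+ x y eq = ∃-root-by-inverse {r} {k} {s} {x} {y} eq sᵏ≈1

  negation-square : ∀ {a b} → a + b ≈ 0 → a * a ≈ b * b
  negation-square {a} {b} a+b≈0 = +-cancelˡ (a * b) (begin
    a * b + a * a    ≡⟨ *-distribˡ-+ a b a ⟨
    a * (b + a)      ≈⟨ *-congˡ a (trans (≡⇒≈ (+-comm b a)) a+b≈0) ⟩
    a * 0            ≡⟨ trans (*-zeroʳ a) (sym (*-zeroʳ b)) ⟩
    b * 0            ≈⟨ *-congˡ b a+b≈0 ⟨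
    b * (a + b)      ≡⟨ *-distribˡ-+ b a b ⟩
    b * a + b * b    ≡⟨ cong (_+ b * b) (*-comm b a) ⟩
    a * b + b * b    ∎)
    where open ≈-Reasoning

  negation-even-power : ∀ {a b} j → a + b ≈ 0 → a ^ (2 * j) ≈ b ^ (2 * j)
  negation-even-power {a} {b} j a+b≈0 = begin
    a ^ (2 * j)    ≡⟨ square-power a ⟨
    (a * a) ^ j    ≈⟨ ^-cong j (negation-square {a} {b} a+b≈0) ⟩
    (b * b) ^ j    ≡⟨ square-power b ⟩
    b ^ (2 * j)    ∎
    where
    open ≈-Reasoning
    square-power : ∀ x → (x * x) ^ j ≡ x ^ (2 * j)
    square-power x = trans (cong (λ y → (x * y) ^ j) (sym (*-identityʳ x))) (^-*-assoc x 2 j)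

  Φ₃-cong : ∀ {a b} → a ≈ b → Φ₃ a ≈ Φ₃ b
  Φ₃-cong a≈b = +-congʳ 1 (+-cong (*-cong a≈b a≈b) a≈b)

  sum-≈0 : ∀ {n} (t : Vector ℕ n) → (∀ i → t i ≈ 0) → sum t ≈ 0
  sum-≈0 {zero}  t t≈0 = refl
  sum-≈0 {suc n} t t≈0 = +-cong (t≈0 zero) (sum-≈0 (tail t) (λ i → t≈0 (suc i)))

  binomial-ends : ∀ n .{{_ : NonZero n}} → (∀ {k} → 0 < k → k < n → p ∣ n C k) →
                  ∀ x → (x + 1) ^ n ≈ x ^ n + 1
  binomial-ends n@(suc m) p∣C x = begin
    (x + 1) ^ n                                      ≡⟨ binomial-theorem n x ⟩
    t zero + sum (tail t)                            ≡⟨ cong (t zero +_) (sum-init-last (tail t)) ⟩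
    t zero + (sum (init (tail t)) + last (tail t))   ≈⟨ +-congˡ (t zero) (+-congʳ (last (tail t)) (sum-≈0 _ inner≈0)) ⟩
    1 + last (tail t)                                ≡⟨ cong suc last≡xⁿ ⟩
    1 + x ^ n                                        ≡⟨ +-comm 1 (x ^ n) ⟩
    x ^ n + 1                                        ∎
    where
    open ≈-Reasoning
    t : Vector ℕ (suc n)
    t k = (n C toℕ k) * x ^ toℕ k
    inner≈0 : ∀ i → init (tail t) i ≈ 0
    inner≈0 i = ∣⇒≈0 (∣m⇒∣m*n _ (p∣C z<s (s<s (subst (_< m) (sym (toℕ-inject₁ i)) (toℕ<n i)))))
    last≡xⁿ : last (tail t) ≡ x ^ n
    last≡xⁿ rewrite toℕ-fromℕ m | nCn≡1 n = *-identityˡ (x ^ n)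

module PrimeField (p : ℕ) .{{_ : NonZero p}} (p-prime : Prime p) where

  open Congruence p

  *≈0⇒≈0⊎≈0 : ∀ {a b} → a * b ≈ 0 → a ≈ 0 ⊎ b ≈ 0
  *≈0⇒≈0⊎≈0 {a} {b} ab≈0 with euclidsLemma a b p-prime (≈0⇒∣ ab≈0)
  ... | inj₁ p∣a = inj₁ (∣⇒≈0 p∣a)
  ... | inj₂ p∣b = inj₂ (∣⇒≈0 p∣b)

  1≉0 : ¬ 1 ≈ 0
  1≉0 1≈0 = ¬prime[1] (subst Prime (∣1⇒≡1 (≈0⇒∣ 1≈0)) p-prime)

  2≉0 : p ≢ 2 → ¬ 2 ≈ 0
  2≉0 p≢2 2≈0 = [ (λ p≡1 → ¬prime[1] (subst Prime p≡1 p-prime)) , p≢2 ]′ (irreducible[2] (≈0⇒∣ 2≈0))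

  *-≉0 : ∀ {a b} → ¬ a ≈ 0 → ¬ b ≈ 0 → ¬ a * b ≈ 0
  *-≉0 a≉0 b≉0 ab≈0 = [ a≉0 , b≉0 ]′ (*≈0⇒≈0⊎≈0 ab≈0)

  ^-≉0 : ∀ {a} n → ¬ a ≈ 0 → ¬ a ^ n ≈ 0
  ^-≉0 zero    a≉0 = 1≉0
  ^-≉0 (suc n) a≉0 = *-≉0 a≉0 (^-≉0 n a≉0)

  *-cancelʳ : ∀ {a b c} → ¬ c ≈ 0 → a * c ≈ b * c → a ≈ b
  *-cancelʳ {a} {b} {c} c≉0 ac≈bc with ∃-difference a b
  ... | d , a+d≈b with *≈0⇒≈0⊎≈0 (+-cancelˡ (a * c) dc≈0)
    where
    open ≈-Reasoning
    dc≈0 : a * c + d * c ≈ a * c + 0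
    dc≈0 = begin
      a * c + d * c   ≡⟨ *-distribʳ-+ c a d ⟨
      (a + d) * c     ≈⟨ *-congʳ c a+d≈b ⟩
      b * c           ≈⟨ ac≈bc ⟨
      a * c           ≡⟨ +-identityʳ (a * c) ⟨
      a * c + 0       ∎
  ... | inj₂ c≈0 = ⊥-elim (c≉0 c≈0)
  ... | inj₁ d≈0 = begin
    a      ≡⟨ +-identityʳ a ⟨
    a + 0  ≈⟨ +-congˡ a d≈0 ⟨
    a + d  ≈⟨ a+d≈b ⟩
    b      ∎
    where open ≈-Reasoning

  ∤-! : ∀ {m} → m < p → p ∤ m !
  ∤-! {zero}  _   p∣1 = 1≉0 (∣⇒≈0 p∣1)
  ∤-! {suc m} m<p p∣m! with euclidsLemma (suc m) (m !) p-prime p∣m!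
  ... | inj₁ p∣m+1 = <⇒≱ m<p (∣⇒≤ p∣m+1)
  ... | inj₂ p∣m!  = ∤-! (<⇒≤ m<p) p∣m!

  -- k! (p - k)! (p C k) = p!, and p divides the right side but neither factorial
  p∣pCk : ∀ {k} → 0 < k → k < p → p ∣ p C k
  p∣pCk {k} 0<k k<p with euclidsLemma (k ! * (p ∸ k) !) (p C k) p-prime p∣factorials*C
    where
    k≤p : k ≤ p
    k≤p = <⇒≤ k<p
    p∣factorials*C : p ∣ k ! * (p ∸ k) ! * (p C k)
    p∣factorials*C = subst (p ∣_) (sym (trans
      (cong (k ! * (p ∸ k) ! *_) (nCk≡n!/k![n-k]! k≤p))
      (m*[n/m]≡n {{k !* (p ∸ k) !≢0}} (k![n∸k]!∣n! k≤p)))) (n∣n! p)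
  ... | inj₂ p∣C = p∣C
  ... | inj₁ p∣factorials = ⊥-elim
    ([ ∤-! k<p , ∤-! (∸-monoʳ-< 0<k (<⇒≤ k<p)) ]′ (euclidsLemma (k !) ((p ∸ k) !) p-prime p∣factorials))

  fermat-little : ∀ a → a ^ p ≈ a
  fermat-little zero    = ≡⇒≈ (0^n≡0 p)
  fermat-little (suc a) = begin
    (1 + a) ^ p    ≡⟨ cong (_^ p) (+-comm 1 a) ⟩
    (a + 1) ^ p    ≈⟨ binomial-ends p p∣pCk a ⟩
    a ^ p + 1      ≈⟨ +-congʳ 1 (fermat-little a) ⟩
    a + 1          ≡⟨ +-comm a 1 ⟩
    1 + a          ∎
    where open ≈-Reasoning

  fermat : ∀ {a} → ¬ a ≈ 0 → a ^ (p ∸ 1) ≈ 1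
  fermat {a} a≉0 = *-cancelʳ a≉0 (begin
    a ^ (p ∸ 1) * a    ≡⟨ *-comm _ a ⟩
    a ^ suc (p ∸ 1)    ≡⟨ cong (a ^_) (suc-pred p) ⟩
    a ^ p              ≈⟨ fermat-little a ⟩
    a                  ≡⟨ *-identityˡ a ⟨
    1 * a              ∎)
    where open ≈-Reasoning

  ∃-inverse : ∀ {a} → ¬ a ≈ 0 → ∃[ b ] b * a ≈ 1
  ∃-inverse {a} a≉0 = a ^ (p ∸ 2) , (begin
    a ^ (p ∸ 2) * a    ≡⟨ *-comm _ a ⟩
    a ^ suc (p ∸ 2)    ≡⟨ cong (a ^_) (+-∸-assoc 1 (nonTrivial⇒n>1 p {{prime⇒nonTrivial p-prime}})) ⟨
    a ^ (p ∸ 1)        ≈⟨ fermat a≉0 ⟩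
    1                  ∎)
    where open ≈-Reasoning

  -- z³ - 1 = (z - 1) Φ₃(z), written with z = 1 + d to stay in ℕ
  primitive-cube-root⇒Φ₃≈0 : ∀ {z} → z ^ 3 ≈ 1 → ¬ z ≈ 1 → Φ₃ z ≈ 0
  primitive-cube-root⇒Φ₃≈0 {z} z³≈1 z≉1 with ∃-difference 1 z
  ... | d , 1+d≈z with *≈0⇒≈0⊎≈0 {d} {Φ₃ (1 + d)} (+-cancelˡ 1 (begin
          1 + d * Φ₃ (1 + d)   ≡⟨ cube-expansion d ⟨
          (1 + d) ^ 3          ≈⟨ ^-cong 3 1+d≈z ⟩
          z ^ 3                ≈⟨ z³≈1 ⟩
          1 + 0                ∎))
    where
    open ≈-Reasoning
    cube-expansion : ∀ d → (1 + d) * ((1 + d) * ((1 + d) * 1)) ≡ 1 + d * ((1 + d) * (1 + d) + (1 + d) + 1)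
    cube-expansion = solve-∀
  ... | inj₁ d≈0  = ⊥-elim (z≉1 (trans (sym 1+d≈z) (+-congˡ 1 d≈0)))
  ... | inj₂ Φ₃≈0 = trans (Φ₃-cong (sym 1+d≈z)) Φ₃≈0

  -- Φ₃(b) - Φ₃(a) = (b - a)(a + b + 1)
  Φ₃-roots : ∀ {a b} → Φ₃ a ≈ 0 → Φ₃ b ≈ 0 → b ≈ a ⊎ a + b + 1 ≈ 0
  Φ₃-roots {a} {b} Φ₃a≈0 Φ₃b≈0 with ∃-difference a b
  ... | d , a+d≈b with *≈0⇒≈0⊎≈0 {d} {a + (a + d) + 1} (+-cancelˡ (Φ₃ a) (begin
          Φ₃ a + d * (a + (a + d) + 1)   ≡⟨ difference-expansion a d ⟨
          Φ₃ (a + d)                     ≈⟨ Φ₃-cong a+d≈b ⟩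
          Φ₃ b                           ≈⟨ Φ₃b≈0 ⟩
          0                              ≈⟨ Φ₃a≈0 ⟨
          Φ₃ a                           ≡⟨ +-identityʳ (Φ₃ a) ⟨
          Φ₃ a + 0                       ∎))
    where
    open ≈-Reasoning
    difference-expansion : ∀ a d → (a + d) * (a + d) + (a + d) + 1 ≡ a * a + a + 1 + d * (a + (a + d) + 1)
    difference-expansion = solve-∀
  ... | inj₁ d≈0 = inj₁ (trans (sym a+d≈b) (trans (+-congˡ a d≈0) (≡⇒≈ (+-identityʳ a))))
  ... | inj₂ Ψ≈0 = inj₂ (trans (+-congʳ 1 (+-congˡ a (sym a+d≈b))) Ψ≈0)

  cube-roots-of-unity : ∀ {ω z} → ω ^ 3 ≈ 1 → ¬ ω ≈ 1 → z ^ 3 ≈ 1 → z ≈ 1 ⊎ z ≈ ω ⊎ z ≈ ω * ω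
  cube-roots-of-unity {ω} {z} ω³≈1 ω≉1 z³≈1 with z % p ≟ 1 % p
  ... | yes z≈1 = inj₁ z≈1
  ... | no  z≉1 with Φ₃-roots (primitive-cube-root⇒Φ₃≈0 ω³≈1 ω≉1) (primitive-cube-root⇒Φ₃≈0 z³≈1 z≉1)
  ...   | inj₁ z≈ω    = inj₂ (inj₁ z≈ω)
  ...   | inj₂ ω+z+1≈0 = inj₂ (inj₂ (+-cancelˡ (ω + 1) (begin
          ω + 1 + z       ≡⟨ +-comm-middle ω 1 z ⟩
          ω + z + 1       ≈⟨ ω+z+1≈0 ⟩
          0               ≈⟨ primitive-cube-root⇒Φ₃≈0 ω³≈1 ω≉1 ⟨
          ω * ω + ω + 1   ≡⟨ rotate (ω * ω) ω 1 ⟩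
          ω + 1 + ω * ω   ∎)))
    where
    open ≈-Reasoning
    +-comm-middle : ∀ a b c → a + b + c ≡ a + c + b
    +-comm-middle = solve-∀
    rotate : ∀ a b c → a + b + c ≡ b + c + a
    rotate = solve-∀

  [a^k]³≈1 : ∀ {a k} → 3 * k ≡ p ∸ 1 → ¬ a ≈ 0 → (a ^ k) ^ 3 ≈ 1
  [a^k]³≈1 {a} {k} 3k≡p∸1 a≉0 = begin
    (a ^ k) ^ 3    ≡⟨ [a^m]^n≡[a^n]^m a k 3 ⟩
    (a ^ 3) ^ k    ≡⟨ ^-*-assoc a 3 k ⟩
    a ^ (3 * k)    ≡⟨ cong (a ^_) 3k≡p∸1 ⟩
    a ^ (p ∸ 1)    ≈⟨ fermat a≉0 ⟩
    1              ∎
    where open ≈-Reasoning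

binomialValue : ℕ → ℕ → ℕ → ℕ
binomialValue r m x = x ^ r * (x ^ m + 1)

module BinomialPermutation (p : ℕ) .{{_ : NonZero p}} (p-prime : Prime p) where

  open Congruence p
  open PrimeField p p-prime

  binomialValue-cong : ∀ {r m a b} → a ≈ b → binomialValue r m a ≈ binomialValue r m b
  binomialValue-cong {r} {m} a≈b = *-cong (^-cong r a≈b) (+-congʳ 1 (^-cong m a≈b))

  binomialMap-injective : ∀ {r e} → Injective _≡_ _≡_ (binomialMap p r e) →
                          Injective _≈_ _≈_ (binomialValue r (e * ((p ∸ 1) / 3)))
  binomialMap-injective {r} {e} injective {a} {b} f[a]≈f[b] = begin
    a % p             ≡⟨ toℕ-fromℕ< (m%n<n a p) ⟨
    toℕ (residue a)   ≡⟨ cong toℕ (injective (toℕ-injective (begin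
      toℕ (binomialMap p r e (residue a))   ≡⟨ toℕ-fromℕ< (m%n<n _ p) ⟩
      f (toℕ (residue a)) % p               ≡⟨ binomialValue-cong {r} {m} (residue-≈ a) ⟩
      f a % p                               ≡⟨ f[a]≈f[b] ⟩
      f b % p                               ≡⟨ binomialValue-cong {r} {m} (residue-≈ b) ⟨
      f (toℕ (residue b)) % p               ≡⟨ toℕ-fromℕ< (m%n<n _ p) ⟨
      toℕ (binomialMap p r e (residue b))   ∎))) ⟩
    toℕ (residue b)   ≡⟨ toℕ-fromℕ< (m%n<n b p) ⟩
    b % p             ∎
    where
    open ≡-Reasoning
    m : ℕ
    m = e * ((p ∸ 1) / 3)
    f : ℕ → ℕ
    f = binomialValue r m
    residue : ℕ → Fin p
    residue a = fromℕ< (m%n<n a p)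
    residue-≈ : ∀ a → toℕ (residue a) ≈ a
    residue-≈ a = trans (≡⇒≈ (toℕ-fromℕ< (m%n<n a p))) (%-≈ a)

  kth-powers-collide : ∀ {r e k x y} → gcd r k ≡ 1 → Injective _≈_ _≈_ (binomialValue r (e * k)) →
                       ¬ binomialValue r (e * k) x ≈ 0 →
                       binomialValue r (e * k) y ^ k ≈ binomialValue r (e * k) x ^ k → x ^ k ≈ y ^ k
  kth-powers-collide {r} {e} {k} {x} {y} gcd≡1 f-injective F≉0 Gᵏ≈Fᵏ = from-root (∃-root {r} {k} gcd≡1 sᵏ≈1)
    where
    open ≈-Reasoning
    f : ℕ → ℕ
    f = binomialValue r (e * k)
    F G s : ℕ
    F = f x
    G = f y
    s = G * proj₁ (∃-inverse F≉0)
    sF≈G : s * F ≈ G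
    sF≈G = begin
      G * proj₁ (∃-inverse F≉0) * F     ≡⟨ *-assoc G _ F ⟩
      G * (proj₁ (∃-inverse F≉0) * F)   ≈⟨ *-congˡ G (proj₂ (∃-inverse F≉0)) ⟩
      G * 1                             ≡⟨ *-identityʳ G ⟩
      G                                 ∎
    sᵏ≈1 : s ^ k ≈ 1
    sᵏ≈1 = *-cancelʳ (^-≉0 k F≉0) (begin
      s ^ k * F ^ k    ≡⟨ ^-distribʳ-* s F k ⟨
      (s * F) ^ k      ≈⟨ ^-cong k sF≈G ⟩
      G ^ k            ≈⟨ Gᵏ≈Fᵏ ⟩
      F ^ k            ≡⟨ *-identityˡ (F ^ k) ⟨
      1 * F ^ k        ∎)
    from-root : ∃[ t ] t ^ k ≈ 1 × t ^ r ≈ s → x ^ k ≈ y ^ k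
    from-root (t , tᵏ≈1 , tʳ≈s) = begin
      x ^ k            ≡⟨ *-identityʳ (x ^ k) ⟨
      x ^ k * 1        ≈⟨ *-congˡ (x ^ k) tᵏ≈1 ⟨
      x ^ k * t ^ k    ≡⟨ ^-distribʳ-* x t k ⟨
      (x * t) ^ k      ≈⟨ ^-cong k (f-injective f[xt]≈G) ⟩
      y ^ k            ∎
      where
      rearrange : ∀ a b c → a * b * (c * 1 + 1) ≡ b * (a * (c + 1))
      rearrange = solve-∀
      f[xt]≈G : f (x * t) ≈ G
      f[xt]≈G = begin
        (x * t) ^ r * ((x * t) ^ (e * k) + 1)
          ≡⟨ cong₂ (λ a b → a * (b + 1)) (^-distribʳ-* x t r) (^-distribʳ-* x t (e * k)) ⟩
        x ^ r * t ^ r * (x ^ (e * k) * t ^ (e * k) + 1)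
          ≈⟨ *-cong (*-congˡ (x ^ r) tʳ≈s) (+-congʳ 1 (*-congˡ (x ^ (e * k)) (^-*-≈1 k e tᵏ≈1))) ⟩
        x ^ r * s * (x ^ (e * k) * 1 + 1)
          ≡⟨ rearrange (x ^ r) s (x ^ (e * k)) ⟩
        s * F
          ≈⟨ sF≈G ⟩
        G ∎

  module _ {r e k : ℕ} (3k≡p∸1 : 3 * k ≡ p ∸ 1) (2∣k : 2 ∣ k) (gcd[r,k]≡1 : gcd r k ≡ 1)
           (gcd[e,3]≡1 : gcd e 3 ≡ 1) (2≉0 : ¬ 2 ≈ 0) (2ᵏ≉1 : ¬ 2 ^ k ≈ 1) where

    private
      f : ℕ → ℕ
      f = binomialValue r (e * k)

      ω v : ℕ
      ω = 2 ^ k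
      v = 2 ^ (e * k)

    ω³≈1 : ω ^ 3 ≈ 1
    ω³≈1 = [a^k]³≈1 {2} {k} 3k≡p∸1 2≉0

    ω≉ω² : ¬ ω ≈ ω * ω
    ω≉ω² ω≈ω² = 2ᵏ≉1 (sym (*-cancelʳ (^-≉0 k 2≉0) (trans (≡⇒≈ (*-identityˡ ω)) ω≈ω²)))

    1≉ω² : ¬ 1 ≈ ω * ω
    1≉ω² 1≈ω² = 2ᵏ≉1 (begin
      ω                ≡⟨ *-identityʳ ω ⟨
      ω * 1            ≈⟨ *-congˡ ω 1≈ω² ⟩
      ω * (ω * ω)      ≡⟨ cong (λ z → ω * (ω * z)) (*-identityʳ ω) ⟨
      ω ^ 3            ≈⟨ ω³≈1 ⟩
      1                ∎)
      where open ≈-Reasoning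

    v³≈1 : v ^ 3 ≈ 1
    v³≈1 = begin
      v ^ 3            ≡⟨ cong (_^ 3) (trans (cong (2 ^_) (*-comm e k)) (sym (^-*-assoc 2 k e))) ⟩
      (ω ^ e) ^ 3      ≡⟨ [a^m]^n≡[a^n]^m ω e 3 ⟩
      (ω ^ 3) ^ e      ≈⟨ ^-≈1 e ω³≈1 ⟩
      1                ∎
      where open ≈-Reasoning

    v≉1 : ¬ v ≈ 1
    v≉1 v≈1 = 2ᵏ≉1 (≈1-if-coprime-powers {ω} {e} {3} gcd[e,3]≡1 ωᵉ≈1 ω³≈1)
      where
      ωᵉ≈1 : ω ^ e ≈ 1
      ωᵉ≈1 = trans (≡⇒≈ (trans (^-*-assoc 2 k e) (cong (2 ^_) (*-comm k e)))) v≈1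

    Φ₃v≈0 : Φ₃ v ≈ 0
    Φ₃v≈0 = primitive-cube-root⇒Φ₃≈0 v³≈1 v≉1

    v+1≉0 : ¬ v + 1 ≈ 0
    v+1≉0 v+1≈0 = *-≉0 v≉0 v≉0 (begin
      v * v              ≡⟨ +-identityʳ (v * v) ⟨
      v * v + 0          ≈⟨ +-congˡ (v * v) v+1≈0 ⟨
      v * v + (v + 1)    ≡⟨ +-assoc (v * v) v 1 ⟨
      Φ₃ v               ≈⟨ Φ₃v≈0 ⟩
      0                  ∎)
      where
      open ≈-Reasoning
      v≉0 : ¬ v ≈ 0
      v≉0 = ^-≉0 (e * k) 2≉0

    f[1]≡2 : f 1 ≡ 2
    f[1]≡2 rewrite ^-zeroˡ r | ^-zeroˡ (e * k) = refl

    f[2]≉0 : ¬ f 2 ≈ 0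
    f[2]≉0 = *-≉0 (^-≉0 r 2≉0) v+1≉0

    f[4]+f[2]²≈0 : f 4 + f 2 * f 2 ≈ 0
    f[4]+f[2]²≈0 = begin
      f 4 + f 2 * f 2
        ≡⟨ cong (λ a → a * (4 ^ (e * k) + 1) + f 2 * f 2) (^-distribʳ-* 2 2 r) ⟩
      2 ^ r * 2 ^ r * (4 ^ (e * k) + 1) + f 2 * f 2
        ≡⟨ cong (λ a → 2 ^ r * 2 ^ r * (a + 1) + f 2 * f 2) (^-distribʳ-* 2 2 (e * k)) ⟩
      2 ^ r * 2 ^ r * (v * v + 1) + 2 ^ r * (v + 1) * (2 ^ r * (v + 1))
        ≡⟨ expansion (2 ^ r) v ⟩
      2 ^ r * 2 ^ r * 2 * Φ₃ v
        ≈⟨ *-congˡ (2 ^ r * 2 ^ r * 2) Φ₃v≈0 ⟩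
      2 ^ r * 2 ^ r * 2 * 0
        ≡⟨ *-zeroʳ (2 ^ r * 2 ^ r * 2) ⟩
      0 ∎
      where
      open ≈-Reasoning
      expansion : ∀ R v → R * R * (v * v + 1) + R * (v + 1) * (R * (v + 1)) ≡ R * R * 2 * (v * v + v + 1)
      expansion = solve-∀

    f[4]ᵏ≈[f[2]ᵏ]² : f 4 ^ k ≈ f 2 ^ k * f 2 ^ k
    f[4]ᵏ≈[f[2]ᵏ]² = begin
      f 4 ^ k                  ≡⟨ cong (f 4 ^_) k≡2j ⟩
      f 4 ^ (2 * j)            ≈⟨ negation-even-power j f[4]+f[2]²≈0 ⟩
      (f 2 * f 2) ^ (2 * j)    ≡⟨ cong ((f 2 * f 2) ^_) k≡2j ⟨
      (f 2 * f 2) ^ k          ≡⟨ ^-distribʳ-* (f 2) (f 2) k ⟩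
      f 2 ^ k * f 2 ^ k        ∎
      where
      open ≈-Reasoning
      j : ℕ
      j = quotient 2∣k
      k≡2j : k ≡ 2 * j
      k≡2j = m∣n⇒n≡m*quotient 2∣k

    ω²ω²≈ω : ω * ω * (ω * ω) ≈ ω
    ω²ω²≈ω = begin
      ω * ω * (ω * ω)    ≡⟨ regroup ω ⟩
      ω ^ 3 * ω          ≈⟨ *-congʳ ω ω³≈1 ⟩
      1 * ω              ≡⟨ *-identityˡ ω ⟩
      ω                  ∎
      where
      open ≈-Reasoning
      regroup : ∀ w → w * w * (w * w) ≡ w * (w * (w * 1)) * w
      regroup = solve-∀

    binomial-not-injective : ¬ Injective _≈_ _≈_ f
    binomial-not-injective f-injective =
      ⊥-from-cube-root (cube-roots-of-unity ω³≈1 2ᵏ≉1 ([a^k]³≈1 {f 2} {k} 3k≡p∸1 f[2]≉0))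
      where
      open ≈-Reasoning
      collide : ∀ {x y} → ¬ f x ≈ 0 → f y ^ k ≈ f x ^ k → x ^ k ≈ y ^ k
      collide {x} {y} = kth-powers-collide {r} {e} {k} {x} {y} gcd[r,k]≡1 f-injective
      f[1]≉0 : ¬ f 1 ≈ 0
      f[1]≉0 = subst (λ a → ¬ a ≈ 0) (sym f[1]≡2) 2≉0
      f[1]ᵏ≡ω : f 1 ^ k ≡ ω
      f[1]ᵏ≡ω = cong (_^ k) f[1]≡2
      4ᵏ≡ω² : 4 ^ k ≡ ω * ω
      4ᵏ≡ω² = ^-distribʳ-* 2 2 k
      ⊥-from-cube-root : f 2 ^ k ≈ 1 ⊎ f 2 ^ k ≈ ω ⊎ f 2 ^ k ≈ ω * ω → ⊥
      ⊥-from-cube-root (inj₁ f[2]ᵏ≈1) = ω≉ω² (trans (collide {2} {4} f[2]≉0 (begin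
        f 4 ^ k              ≈⟨ f[4]ᵏ≈[f[2]ᵏ]² ⟩
        f 2 ^ k * f 2 ^ k    ≈⟨ *-cong f[2]ᵏ≈1 f[2]ᵏ≈1 ⟩
        1                    ≈⟨ f[2]ᵏ≈1 ⟨
        f 2 ^ k              ∎)) (≡⇒≈ 4ᵏ≡ω²))
      ⊥-from-cube-root (inj₂ (inj₁ f[2]ᵏ≈ω)) = 2ᵏ≉1 (sym (begin
        1                    ≡⟨ ^-zeroˡ k ⟨
        1 ^ k                ≈⟨ collide {1} {2} f[1]≉0 (trans f[2]ᵏ≈ω (≡⇒≈ (sym f[1]ᵏ≡ω))) ⟩
        2 ^ k                ∎))
      ⊥-from-cube-root (inj₂ (inj₂ f[2]ᵏ≈ω²)) = 1≉ω² (begin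
        1                    ≡⟨ ^-zeroˡ k ⟨
        1 ^ k                ≈⟨ collide {1} {4} f[1]≉0 (begin
          f 4 ^ k              ≈⟨ f[4]ᵏ≈[f[2]ᵏ]² ⟩
          f 2 ^ k * f 2 ^ k    ≈⟨ *-cong f[2]ᵏ≈ω² f[2]ᵏ≈ω² ⟩
          ω * ω * (ω * ω)      ≈⟨ ω²ω²≈ω ⟩
          ω                    ≡⟨ f[1]ᵏ≡ω ⟨
          f 1 ^ k              ∎) ⟩
        4 ^ k                ≡⟨ 4ᵏ≡ω² ⟩
        ω * ω                ∎)

proposition4p3 : (p : ℕ) → .{{_ : NonZero p}} → Prime p → p ≢ 2 → 3 ∣ p ∸ 1
    → p ∤ (2 ^ ((p ∸ 1) / 3) ∸ 1)
    → (r : ℕ) → 0 < r → r < p ∸ 1 → gcd r ((p ∸ 1) / 3) ≡ 1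
    → (e : ℕ) → 0 < e → gcd e 3 ≡ 1
    → ¬ IsPermutationPolynomial p (binomialMap p r e)
proposition4p3 p p-prime p≢2 3∣p∸1 p∤2ᵏ∸1 r _ _ gcd[r,k]≡1 e _ gcd[e,3]≡1 (injective , _) =
  binomial-not-injective {r} {e} 3k≡p∸1 2∣k gcd[r,k]≡1 gcd[e,3]≡1 (2≉0 p≢2) 2ᵏ≉1
    (binomialMap-injective {r} {e} injective)
  where
  open Congruence p
  open PrimeField p p-prime
  open BinomialPermutation p p-prime
  k : ℕ
  k = (p ∸ 1) / 3
  3k≡p∸1 : 3 * k ≡ p ∸ 1
  3k≡p∸1 = m*[n/m]≡n 3∣p∸1
  2∣k : 2 ∣ k
  2∣k = 2∣3k⇒2∣k (subst (2 ∣_) (sym 3k≡p∸1) (2∣odd-prime∸1 p-prime p≢2))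
  2ᵏ≉1 : ¬ 2 ^ k ≈ 1
  2ᵏ≉1 2ᵏ≈1 = p∤2ᵏ∸1 (≈0⇒∣ (∸-≈0 (m^n>0 2 k) 2ᵏ≈1))
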